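{- Let $\mathbf A$ be a non-idempotent finitely subdirectly irreducible De Morgan monoid, and let $G=[\neg(f^2))=\{a\in A:\neg(f^2)\leqslant a\}$. Then $G$ is a deductive filter, $\mathbf A/G$ is a totally ordered odd Sugihara monoid, the class $e/G$ is the interval $[\neg(f^2),f^2]$, and $a/G=\{a\}$ for every $a\in A\setminus[\neg(f^2),f^2]$.
   Context: An involutive residuated lattice (IRL) is an algebra $\langle A;\cdot,\wedge,\vee,\neg,e\rangle$ with $\langle A;\cdot,e\rangle$ a commutative monoid, $\langle A;\wedge,\vee\rangle$ a lattice, $\neg\neg x=x$, and $x\cdot y\leqslant z\iff\neg z\cdot y\leqslant\neg x$. Define $x\to y:=\neg(x\cdot\neg y)$, $f:=\neg e$, $f^2:=f\cdot f$. A De Morgan monoid is an IRL with distributive lattice satisfying $x\leqslant x\cdot x$; it is idempotent if $a\cdot a=a$ for all $a$. A Sugihara monoid is an idempotent De Morgan monoid; it is odd if $f=e$. An algebra is finitely subdirectly irreducible (FSI) if its identity congruence is meet-irreducible in its congruence lattice. A deductive filter is a lattice filter containing $e$ and closed under $\cdot$; for a deductive filter $G$, $\mathbf A/G$ denotes the quotient by the congruence $\{\langle a,b\rangle: a\to b,\ b\to a\in G\}$, and $a/G$ the class of $a$. $[a,b]=\{x:a\leqslant x\leqslant b\}$. -}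

module Defs where

open import Data.Product using (_×_; _,_; Σ)
open import Data.Sum using (_⊎_)
open import Relation.Nullary using (¬_)
open import Relation.Binary.PropositionalEquality using (_≡_)
open import Relation.Binary.Structures using (IsEquivalence)
open import Function.Bundles using (_⇔_)
import Algebra.Structures as AS
import Algebra.Lattice.Structures as LS

record DeMorganMonoid : Set₁ where
  infixl 7 _·_
  infixr 6 _∧_
  infixr 5 _∨_
  infix  4 _≤_
  field
    Carrier : Set
    _·_ : Carrier → Carrier → Carrier
    _∧_ : Carrier → Carrier → Carrier
    _∨_ : Carrier → Carrier → Carrier
    ∼_  : Carrier → Carrier
    e   : Carrier

  _≤_ : Carrier → Carrier → Set
  x ≤ y = x ∧ y ≡ x

  field
    ·-isCommutativeMonoid : AS.IsCommutativeMonoid _≡_ _·_ e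
    isDistributiveLattice : LS.IsDistributiveLattice _≡_ _∨_ _∧_
    involution            : ∀ x → ∼ (∼ x) ≡ x
    residuation           : ∀ x y z → (x · y ≤ z) ⇔ (∼ z · y ≤ ∼ x)
    square-increasing     : ∀ x → x ≤ x · x

  _⇒_ : Carrier → Carrier → Carrier
  x ⇒ y = ∼ (x · ∼ y)

  f : Carrier
  f = ∼ e

  f² : Carrier
  f² = f · f

  Idempotent : Set
  Idempotent = ∀ a → a · a ≡ a

  record IsCongruence (θ : Carrier → Carrier → Set) : Set where
    field
      isEquivalence : IsEquivalence θ
      ·-cong : ∀ {a b c d} → θ a b → θ c d → θ (a · c) (b · d)
      ∧-cong : ∀ {a b c d} → θ a b → θ c d → θ (a ∧ c) (b ∧ d)
      ∨-cong : ∀ {a b c d} → θ a b → θ c d → θ (a ∨ c) (b ∨ d)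
      ∼-cong : ∀ {a b} → θ a b → θ (∼ a) (∼ b)

  IsIdentity : (Carrier → Carrier → Set) → Set
  IsIdentity θ = ∀ a b → θ a b → a ≡ b

  -- finitely subdirectly irreducible: the identity congruence is
  -- meet-irreducible in the congruence lattice (it is not the total
  -- congruence, and if θ ∩ φ is the identity, then θ or φ is the identity)
  FSI : Set₁
  FSI = ¬ (∀ (a b : Carrier) → a ≡ b)
      × (∀ (θ φ : Carrier → Carrier → Set) → IsCongruence θ → IsCongruence φ
          → IsIdentity (λ a b → θ a b × φ a b)
          → IsIdentity θ ⊎ IsIdentity φ)

  record IsDeductiveFilter (G : Carrier → Set) : Set where
    field
      nonempty   : Σ Carrier G
      up-closed  : ∀ {a b} → G a → a ≤ b → G b
      ∧-closed   : ∀ {a b} → G a → G b → G (a ∧ b)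
      e∈         : G e
      ·-closed   : ∀ {a b} → G a → G b → G (a · b)

  -- the congruence associated with a deductive filter G:
  -- a ≡_G b  iff  a → b ∈ G and b → a ∈ G ; A/G is A modulo this relation
  _≈[_]_ : Carrier → (Carrier → Set) → Carrier → Set
  a ≈[ G ] b = G (a ⇒ b) × G (b ⇒ a)

  _∈[_,_] : Carrier → Carrier → Carrier → Set
  x ∈[ a , b ] = (a ≤ x) × (x ≤ b)

{-# OPTIONS --safe #-}
-- For p ≤ e the principal filter ↑p is deductive, and a, b are congruent
-- modulo ↑p exactly when p · a ≤ b and p · b ≤ a. In an FSI algebra every x
-- satisfies e ≤ x or x ≤ f: otherwise the congruences of ↑(x ∧ e) and
-- ↑(∼ x ∧ e) would both be nontrivial, yet their meet is trivial because
-- e ≤ x ∨ ∼ x. Take p = ∼f², an idempotent below e with ∼f² · a · a ≤ a.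
-- The dichotomy rules out f² ≤ f (that would make A idempotent), so e ≤ f²
-- and f ≡ e modulo ↑∼f²; applied to ∼f² · a · ∼ b it makes the quotient a
-- chain. If e ≤ ∼f² · a then a ≤ ∼f² · a, which forces the class of a to
-- be {a}; if this fails for both a and ∼ a, then a lies in [∼f², f²].
module Submission where

open import Defs
open import Algebra.Bundles using (CommutativeMonoid)
import Algebra.Lattice.Bundles as Algebraic
import Algebra.Lattice.Properties.Lattice as LatticeProperties
import Algebra.Lattice.Structures as LS
import Algebra.Properties.CommutativeSemigroup as CommutativeSemigroupProperties
import Algebra.Solver.CommutativeMonoid as CommutativeMonoidSolver
import Algebra.Structures as AS
open import Data.Empty using (⊥-elim)
open import Data.Product using (_×_; _,_; proj₁; proj₂)
open import Data.Sum using (_⊎_; inj₁; inj₂)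
open import Function.Bundles using (_⇔_; mk⇔; Equivalence)
import Relation.Binary.Lattice as OrderTheoretic
open import Relation.Binary.PropositionalEquality
  using (_≡_; refl; sym; trans; cong; subst; isEquivalence)
import Relation.Binary.Reasoning.PartialOrder as ≤-Reasoning
open import Relation.Binary.Structures using (IsEquivalence)
open import Relation.Nullary using (¬_)

module DeMorganMonoidProperties (A : DeMorganMonoid) where
  open DeMorganMonoid A
  open AS.IsCommutativeMonoid ·-isCommutativeMonoid using ()
    renaming (assoc to ·-assoc; comm to ·-comm; identityˡ to ·-identityˡ; identityʳ to ·-identityʳ)
  open LS.IsDistributiveLattice isDistributiveLattice using (isLattice; ∧-distribʳ-∨)

  ·-commutativeMonoid : CommutativeMonoid _ _
  ·-commutativeMonoid = record { isCommutativeMonoid = ·-isCommutativeMonoid }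

  open CommutativeSemigroupProperties (CommutativeMonoid.commutativeSemigroup ·-commutativeMonoid)
    using (interchange)
  open CommutativeMonoidSolver ·-commutativeMonoid using (solve; _⊕_; _⊜_)

  ∧-∨-lattice : Algebraic.Lattice _ _
  ∧-∨-lattice = record { isLattice = isLattice }

  -- The library orders a lattice by x ≡ x ∧ y, Defs by x ∧ y ≡ x.
  private
    module Natural = OrderTheoretic.Lattice (LatticeProperties.∨-∧-orderTheoreticLattice ∧-∨-lattice)

  ≤-isLattice : OrderTheoretic.IsLattice _≡_ _≤_ _∨_ _∧_
  ≤-isLattice = record
    { isPartialOrder = record
      { isPreorder = record
        { isEquivalence = isEquivalence
        ; reflexive     = λ x≡y → sym (Natural.reflexive x≡y)
        ; trans         = λ x≤y y≤z → sym (Natural.trans (sym x≤y) (sym y≤z))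
        }
      ; antisym = λ x≤y y≤x → Natural.antisym (sym x≤y) (sym y≤x)
      }
    ; supremum = λ x y →
        sym (Natural.x≤x∨y x y) , sym (Natural.y≤x∨y x y) ,
        λ z x≤z y≤z → sym (Natural.∨-least (sym x≤z) (sym y≤z))
    ; infimum = λ x y →
        sym (Natural.x∧y≤x x y) , sym (Natural.x∧y≤y x y) ,
        λ z z≤x z≤y → sym (Natural.∧-greatest (sym z≤x) (sym z≤y))
    }

  ≤-lattice : OrderTheoretic.Lattice _ _ _
  ≤-lattice = record { isLattice = ≤-isLattice }

  open OrderTheoretic.Lattice ≤-lattice
    using (poset; x≤x∨y; y≤x∨y; ∨-least; x∧y≤x; x∧y≤y; ∧-greatest)
    renaming (refl to ≤-refl; reflexive to ≤-reflexive; trans to ≤-trans; antisym to ≤-antisym)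
  open ≤-Reasoning poset

  ∼-antitone : ∀ {a b} → a ≤ b → ∼ b ≤ ∼ a
  ∼-antitone {a} {b} a≤b = begin
    ∼ b      ≡⟨ ·-identityʳ (∼ b) ⟨
    ∼ b · e  ≤⟨ Equivalence.to (residuation a e b) a·e≤b ⟩
    ∼ a      ∎
    where
    a·e≤b : a · e ≤ b
    a·e≤b = begin a · e ≡⟨ ·-identityʳ a ⟩ a ≤⟨ a≤b ⟩ b ∎

  ∼-swapʳ : ∀ {a b} → a ≤ ∼ b → b ≤ ∼ a
  ∼-swapʳ {a} {b} a≤∼b = begin
    b      ≡⟨ involution b ⟨
    ∼ ∼ b  ≤⟨ ∼-antitone a≤∼b ⟩
    ∼ a    ∎

  ∼-swapˡ : ∀ {a b} → ∼ a ≤ b → ∼ b ≤ a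
  ∼-swapˡ {a} {b} ∼a≤b = begin
    ∼ b    ≤⟨ ∼-antitone ∼a≤b ⟩
    ∼ ∼ a  ≡⟨ involution a ⟩
    a      ∎

  ·≤f⇒≤∼ : ∀ {x y} → x · y ≤ f → x ≤ ∼ y
  ·≤f⇒≤∼ {x} {y} x·y≤f = begin
    x        ≡⟨ ·-identityˡ x ⟨
    e · x    ≡⟨ cong (_· x) (involution e) ⟨
    ∼ f · x  ≤⟨ Equivalence.to (residuation y x f) y·x≤f ⟩
    ∼ y      ∎
    where
    y·x≤f : y · x ≤ f
    y·x≤f = begin y · x ≡⟨ ·-comm y x ⟩ x · y ≤⟨ x·y≤f ⟩ f ∎

  ≤∼⇒·≤f : ∀ {x y} → x ≤ ∼ y → x · y ≤ f
  ≤∼⇒·≤f {x} {y} x≤∼y = begin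
    x · y  ≡⟨ ·-comm x y ⟩
    y · x  ≤⟨ Equivalence.from (residuation y x f) ∼f·x≤∼y ⟩
    f      ∎
    where
    ∼f·x≤∼y : ∼ f · x ≤ ∼ y
    ∼f·x≤∼y = begin ∼ f · x ≡⟨ cong (_· x) (involution e) ⟩ e · x ≡⟨ ·-identityˡ x ⟩ x ≤⟨ x≤∼y ⟩ ∼ y ∎

  curry : ∀ {x y z} → x · y ≤ z → x ≤ y ⇒ z
  curry {x} {y} {z} x·y≤z = ·≤f⇒≤∼ (begin
    x · (y · ∼ z)  ≡⟨ ·-assoc x y (∼ z) ⟨
    x · y · ∼ z    ≤⟨ ≤∼⇒·≤f x·y≤∼∼z ⟩
    f              ∎)
    where
    x·y≤∼∼z : x · y ≤ ∼ ∼ z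
    x·y≤∼∼z = begin x · y ≤⟨ x·y≤z ⟩ z ≡⟨ involution z ⟨ ∼ ∼ z ∎

  uncurry : ∀ {x y z} → x ≤ y ⇒ z → x · y ≤ z
  uncurry {x} {y} {z} x≤y⇒z = begin
    x · y      ≤⟨ ·≤f⇒≤∼ (begin
                    x · y · ∼ z    ≡⟨ ·-assoc x y (∼ z) ⟩
                    x · (y · ∼ z)  ≤⟨ ≤∼⇒·≤f x≤y⇒z ⟩
                    f              ∎) ⟩
    ∼ ∼ z      ≡⟨ involution z ⟩
    z          ∎

  ·-monoˡ-≤ : ∀ {a b c} → a ≤ b → a · c ≤ b · c
  ·-monoˡ-≤ {a} {b} {c} a≤b = uncurry (≤-trans a≤b (curry ≤-refl))

  ·-monoʳ-≤ : ∀ {a b c} → a ≤ b → c · a ≤ c · b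
  ·-monoʳ-≤ {a} {b} {c} a≤b = begin
    c · a  ≡⟨ ·-comm c a ⟩
    a · c  ≤⟨ ·-monoˡ-≤ a≤b ⟩
    b · c  ≡⟨ ·-comm b c ⟩
    c · b  ∎

  ·-mono-≤ : ∀ {a b c d} → a ≤ b → c ≤ d → a · c ≤ b · d
  ·-mono-≤ a≤b c≤d = ≤-trans (·-monoˡ-≤ a≤b) (·-monoʳ-≤ c≤d)

  x·∼x≤f : ∀ x → x · ∼ x ≤ f
  x·∼x≤f x = ≤∼⇒·≤f (≤-reflexive (sym (involution x)))

  ≤e⇒·≤ : ∀ {p x} → p ≤ e → p · x ≤ x
  ≤e⇒·≤ {p} {x} p≤e = begin p · x ≤⟨ ·-monoˡ-≤ p≤e ⟩ e · x ≡⟨ ·-identityˡ x ⟩ x ∎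

  e≤⇒⇒≤ : ∀ {a b} → e ≤ a ⇒ b → a ≤ b
  e≤⇒⇒≤ {a} {b} e≤a⇒b = begin a ≡⟨ ·-identityˡ a ⟨ e · a ≤⟨ uncurry e≤a⇒b ⟩ b ∎

  ⇒-contrapose : ∀ a b → a ⇒ b ≡ (∼ b) ⇒ (∼ a)
  ⇒-contrapose a b = cong ∼_ (trans (·-comm a (∼ b)) (cong (∼ b ·_) (sym (involution a))))

  ↑_ : Carrier → Carrier → Set
  ↑ p = p ≤_

  Θ : Carrier → Carrier → Carrier → Set
  Θ p a b = a ≈[ ↑ p ] b

  ↑-isDeductiveFilter : ∀ {p} → p ≤ e → IsDeductiveFilter (↑ p)
  ↑-isDeductiveFilter {p} p≤e = record
    { nonempty  = e , p≤e
    ; up-closed = ≤-trans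
    ; ∧-closed  = ∧-greatest
    ; e∈        = p≤e
    ; ·-closed  = λ p≤a p≤b → ≤-trans (square-increasing p) (·-mono-≤ p≤a p≤b)
    }

  ·-∨-subdistribˡ : ∀ p a b → p · (a ∨ b) ≤ p · a ∨ p · b
  ·-∨-subdistribˡ p a b = begin
    p · (a ∨ b)  ≡⟨ ·-comm p (a ∨ b) ⟩
    (a ∨ b) · p  ≤⟨ uncurry (∨-least (curry (swap (x≤x∨y _ _))) (curry (swap (y≤x∨y _ _)))) ⟩
    p · a ∨ p · b ∎
    where
    swap : ∀ {x z} → p · x ≤ z → x · p ≤ z
    swap {x} {z} p·x≤z = begin x · p ≡⟨ ·-comm x p ⟩ p · x ≤⟨ p·x≤z ⟩ z ∎

  module _ {p : Carrier} where
    ⇒-·-compat : ∀ {a b c d} → p ≤ a ⇒ b → p ≤ c ⇒ d → p ≤ (a · c) ⇒ (b · d)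
    ⇒-·-compat {a} {b} {c} {d} p≤a⇒b p≤c⇒d = curry (begin
      p · (a · c)        ≤⟨ ·-monoˡ-≤ (square-increasing p) ⟩
      p · p · (a · c)    ≡⟨ interchange p p a c ⟩
      p · a · (p · c)    ≤⟨ ·-mono-≤ (uncurry p≤a⇒b) (uncurry p≤c⇒d) ⟩
      b · d              ∎)

    ⇒-∧-compat : ∀ {a b c d} → p ≤ a ⇒ b → p ≤ c ⇒ d → p ≤ (a ∧ c) ⇒ (b ∧ d)
    ⇒-∧-compat p≤a⇒b p≤c⇒d = curry (∧-greatest
      (≤-trans (·-monoʳ-≤ (x∧y≤x _ _)) (uncurry p≤a⇒b))
      (≤-trans (·-monoʳ-≤ (x∧y≤y _ _)) (uncurry p≤c⇒d)))

    ⇒-∨-compat : ∀ {a b c d} → p ≤ a ⇒ b → p ≤ c ⇒ d → p ≤ (a ∨ c) ⇒ (b ∨ d)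
    ⇒-∨-compat {a} {b} {c} {d} p≤a⇒b p≤c⇒d = curry (begin
      p · (a ∨ c)      ≤⟨ ·-∨-subdistribˡ p a c ⟩
      p · a ∨ p · c    ≤⟨ ∨-least (≤-trans (uncurry p≤a⇒b) (x≤x∨y b d))
                                  (≤-trans (uncurry p≤c⇒d) (y≤x∨y b d)) ⟩
      b ∨ d            ∎)

    ⇒-∼-compat : ∀ {a b} → p ≤ a ⇒ b → p ≤ (∼ b) ⇒ (∼ a)
    ⇒-∼-compat {a} {b} = subst (p ≤_) (⇒-contrapose a b)

    module _ (p≤e : p ≤ e) where
      ⇒-refl : ∀ {a} → p ≤ a ⇒ a
      ⇒-refl = curry (≤e⇒·≤ p≤e)

      ⇒-trans : ∀ {a b c} → p ≤ a ⇒ b → p ≤ b ⇒ c → p ≤ a ⇒ c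
      ⇒-trans {a} {b} {c} p≤a⇒b p≤b⇒c = curry (begin
        p · a            ≤⟨ ·-monoˡ-≤ (square-increasing p) ⟩
        p · p · a        ≡⟨ ·-assoc p p a ⟩
        p · (p · a)      ≤⟨ ·-monoʳ-≤ (uncurry p≤a⇒b) ⟩
        p · b            ≤⟨ uncurry p≤b⇒c ⟩
        c                ∎)

      Θ-isCongruence : IsCongruence (Θ p)
      Θ-isCongruence = record
        { isEquivalence = record
          { refl  = ⇒-refl , ⇒-refl
          ; sym   = λ (a⇒b , b⇒a) → b⇒a , a⇒b
          ; trans = λ (a⇒b , b⇒a) (b⇒c , c⇒b) → ⇒-trans a⇒b b⇒c , ⇒-trans c⇒b b⇒a
          }
        ; ·-cong = λ (a⇒b , b⇒a) (c⇒d , d⇒c) → ⇒-·-compat a⇒b c⇒d , ⇒-·-compat b⇒a d⇒c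
        ; ∧-cong = λ (a⇒b , b⇒a) (c⇒d , d⇒c) → ⇒-∧-compat a⇒b c⇒d , ⇒-∧-compat b⇒a d⇒c
        ; ∨-cong = λ (a⇒b , b⇒a) (c⇒d , d⇒c) → ⇒-∨-compat a⇒b c⇒d , ⇒-∨-compat b⇒a d⇒c
        ; ∼-cong = λ (a⇒b , b⇒a) → ⇒-∼-compat b⇒a , ⇒-∼-compat a⇒b
        }

      Θ-self : Θ p p e
      Θ-self = curry (≤-trans (≤e⇒·≤ p≤e) p≤e) , curry (≤-reflexive (·-identityʳ p))

  e≤x∨∼x : ∀ x → e ≤ x ∨ ∼ x
  e≤x∨∼x x = begin
    e              ≡⟨ involution e ⟨
    ∼ f            ≤⟨ ∼-swapˡ (begin
                        ∼ (x ∨ ∼ x)                  ≤⟨ ∧-greatest (∼-swapˡ (y≤x∨y x (∼ x))) (∼-antitone (x≤x∨y x (∼ x))) ⟩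
                        x ∧ ∼ x                      ≤⟨ square-increasing (x ∧ ∼ x) ⟩
                        (x ∧ ∼ x) · (x ∧ ∼ x)        ≤⟨ ·-mono-≤ (x∧y≤x x (∼ x)) (x∧y≤y x (∼ x)) ⟩
                        x · ∼ x                      ≤⟨ x·∼x≤f x ⟩
                        f                            ∎) ⟩
    x ∨ ∼ x        ∎

  FSI⇒e≤⊎≤f : FSI → ∀ x → e ≤ x ⊎ x ≤ f
  FSI⇒e≤⊎≤f (_ , meet-irreducible) x
    with meet-irreducible (Θ (x ∧ e)) (Θ (∼ x ∧ e))
           (Θ-isCongruence (x∧y≤y x e)) (Θ-isCongruence (x∧y≤y (∼ x) e)) Θ∩Θ-trivial
    where
    e≤x∧e∨∼x∧e : e ≤ (x ∧ e) ∨ (∼ x ∧ e)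
    e≤x∧e∨∼x∧e = begin
      e                      ≤⟨ ∧-greatest (e≤x∨∼x x) ≤-refl ⟩
      (x ∨ ∼ x) ∧ e          ≡⟨ ∧-distribʳ-∨ e x (∼ x) ⟩
      (x ∧ e) ∨ (∼ x ∧ e)    ∎

    both⇒≤ : ∀ {a b} → x ∧ e ≤ a ⇒ b → ∼ x ∧ e ≤ a ⇒ b → a ≤ b
    both⇒≤ p≤a⇒b q≤a⇒b = e≤⇒⇒≤ (≤-trans e≤x∧e∨∼x∧e (∨-least p≤a⇒b q≤a⇒b))

    Θ∩Θ-trivial : IsIdentity (λ a b → Θ (x ∧ e) a b × Θ (∼ x ∧ e) a b)
    Θ∩Θ-trivial a b ((a⇒b , b⇒a) , (a⇒b′ , b⇒a′)) = ≤-antisym (both⇒≤ a⇒b a⇒b′) (both⇒≤ b⇒a b⇒a′)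
  ... | inj₁ trivial = inj₁ (begin
    e      ≡⟨ trivial (x ∧ e) e (Θ-self (x∧y≤y x e)) ⟨
    x ∧ e  ≤⟨ x∧y≤x x e ⟩
    x      ∎)
  ... | inj₂ trivial = inj₂ (∼-swapʳ (begin
    e        ≡⟨ trivial (∼ x ∧ e) e (Θ-self (x∧y≤y (∼ x) e)) ⟨
    ∼ x ∧ e  ≤⟨ x∧y≤x (∼ x) e ⟩
    ∼ x      ∎))

  ·∼a²≤f⇒≤ : ∀ {x a} → x · (∼ a · ∼ a) ≤ f → x ≤ a
  ·∼a²≤f⇒≤ {x} {a} x·∼a²≤f = begin
    x                ≤⟨ ·≤f⇒≤∼ x·∼a²≤f ⟩
    ∼ (∼ a · ∼ a)    ≤⟨ ∼-swapˡ (square-increasing (∼ a)) ⟩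
    a                ∎

  a²·∼a²≤f² : ∀ a → (a · a) · (∼ a · ∼ a) ≤ f²
  a²·∼a²≤f² a = begin
    (a · a) · (∼ a · ∼ a)    ≡⟨ interchange a a (∼ a) (∼ a) ⟩
    (a · ∼ a) · (a · ∼ a)    ≤⟨ ·-mono-≤ (x·∼x≤f a) (x·∼x≤f a) ⟩
    f²                       ∎

  f²≤f⇒idempotent : f² ≤ f → Idempotent
  f²≤f⇒idempotent f²≤f a = ≤-antisym a²≤a (square-increasing a)
    where
    a²≤a : a · a ≤ a
    a²≤a = ·∼a²≤f⇒≤ (≤-trans (a²·∼a²≤f² a) f²≤f)

  ∼f² : Carrier
  ∼f² = ∼ f²

  ∼f²≤e : ∼f² ≤ e
  ∼f²≤e = begin
    ∼ f²   ≤⟨ ∼-antitone (square-increasing f) ⟩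
    ∼ f    ≡⟨ involution e ⟩
    e      ∎

  ∼f²·f²≤f : ∼f² · f² ≤ f
  ∼f²·f²≤f = ≤∼⇒·≤f ≤-refl

  ∼f²·∼f²≡∼f² : ∼f² · ∼f² ≡ ∼f²
  ∼f²·∼f²≡∼f² = ≤-antisym (≤e⇒·≤ ∼f²≤e) (square-increasing ∼f²)

  ∼f²·[∼f²·x]≡∼f²·x : ∀ x → ∼f² · (∼f² · x) ≡ ∼f² · x
  ∼f²·[∼f²·x]≡∼f²·x x = trans (sym (·-assoc ∼f² ∼f² x)) (cong (_· x) ∼f²·∼f²≡∼f²)

  -- f ⇒ e unfolds to ∼ (f · f) = ∼f², so ∼f² · f ≤ e.
  ∼f²·f²≤e : ∼f² · f² ≤ e
  ∼f²·f²≤e = begin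
    ∼f² · (f · f)             ≡⟨ cong (_· f²) ∼f²·∼f²≡∼f² ⟨
    (∼f² · ∼f²) · (f · f)     ≡⟨ interchange ∼f² ∼f² f f ⟩
    (∼f² · f) · (∼f² · f)     ≤⟨ ·-mono-≤ (uncurry ≤-refl) (uncurry ≤-refl) ⟩
    e · e                     ≡⟨ ·-identityˡ e ⟩
    e                         ∎

  ∼f²·a²≤a : ∀ a → ∼f² · (a · a) ≤ a
  ∼f²·a²≤a a = ·∼a²≤f⇒≤ (begin
    ∼f² · (a · a) · (∼ a · ∼ a)      ≡⟨ ·-assoc ∼f² (a · a) (∼ a · ∼ a) ⟩
    ∼f² · ((a · a) · (∼ a · ∼ a))    ≤⟨ ·-monoʳ-≤ (a²·∼a²≤f² a) ⟩
    ∼f² · f²                         ≤⟨ ∼f²·f²≤f ⟩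
    f                                ∎)

  ∼f²·a≤f⇒a≤f² : ∀ {a} → ∼f² · a ≤ f → a ≤ f²
  ∼f²·a≤f⇒a≤f² {a} ∼f²·a≤f = begin
    a          ≤⟨ ·≤f⇒≤∼ (≤-trans (≤-reflexive (·-comm a ∼f²)) ∼f²·a≤f) ⟩
    ∼ ∼f²      ≡⟨ involution f² ⟩
    f²         ∎

  ∼f²·∼a≤f⇒∼f²≤a : ∀ {a} → ∼f² · ∼ a ≤ f → ∼f² ≤ a
  ∼f²·∼a≤f⇒∼f²≤a {a} ∼f²·∼a≤f = ≤-trans (·≤f⇒≤∼ ∼f²·∼a≤f) (≤-reflexive (involution a))

  e≤∼f²·a⇒a≤∼f²·a : ∀ {a} → e ≤ ∼f² · a → a ≤ ∼f² · a
  e≤∼f²·a⇒a≤∼f²·a {a} e≤∼f²·a = begin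
    a                      ≡⟨ ·-identityˡ a ⟨
    e · a                  ≤⟨ ·-monoˡ-≤ e≤∼f²·a ⟩
    ∼f² · a · a            ≡⟨ ·-assoc ∼f² a a ⟩
    ∼f² · (a · a)          ≡⟨ ∼f²·[∼f²·x]≡∼f²·x (a · a) ⟨
    ∼f² · (∼f² · (a · a))  ≤⟨ ·-monoʳ-≤ (∼f²·a²≤a a) ⟩
    ∼f² · a                ∎

  e≤∼f²·a⇒Θ-singleton : ∀ {a b} → e ≤ ∼f² · a → Θ ∼f² b a → b ≡ a
  e≤∼f²·a⇒Θ-singleton {a} {b} e≤∼f²·a (∼f²≤b⇒a , ∼f²≤a⇒b) = ≤-antisym
    (≤-trans (e≤∼f²·a⇒a≤∼f²·a e≤∼f²·b) (uncurry ∼f²≤b⇒a))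
    (≤-trans (e≤∼f²·a⇒a≤∼f²·a e≤∼f²·a) (uncurry ∼f²≤a⇒b))
    where
    e≤∼f²·b : e ≤ ∼f² · b
    e≤∼f²·b = begin
      e                  ≤⟨ e≤∼f²·a ⟩
      ∼f² · a            ≡⟨ ∼f²·[∼f²·x]≡∼f²·x a ⟨
      ∼f² · (∼f² · a)    ≤⟨ ·-monoʳ-≤ (uncurry ∼f²≤a⇒b) ⟩
      ∼f² · b            ∎

  e≤∼f²·a·∼b⇒∼f²·b≤a : ∀ {a b} → e ≤ ∼f² · a · ∼ b → ∼f² · b ≤ a
  e≤∼f²·a·∼b⇒∼f²·b≤a {a} {b} e≤∼f²·a·∼b = ≤-trans (·≤f⇒≤∼ (begin
    ∼f² · b · ∼ a                                    ≡⟨ ·-identityʳ _ ⟨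
    ∼f² · b · ∼ a · e                                ≤⟨ ·-monoʳ-≤ e≤∼f²·a·∼b ⟩
    ∼f² · b · ∼ a · (∼f² · a · ∼ b)                  ≡⟨ rearrange ∼f² a b (∼ a) (∼ b) ⟩
    ∼f² · ∼f² · ((a · ∼ a) · (b · ∼ b))              ≤⟨ ·-mono-≤ (≤-reflexive ∼f²·∼f²≡∼f²) (·-mono-≤ (x·∼x≤f a) (x·∼x≤f b)) ⟩
    ∼f² · f²                                         ≤⟨ ∼f²·f²≤f ⟩
    f                                                ∎))
    (≤-reflexive (involution a))
    where
    rearrange : ∀ c a b a′ b′ → c · b · a′ · (c · a · b′) ≡ c · c · ((a · a′) · (b · b′))
    rearrange = solve 5 (λ c a b a′ b′ → ((c ⊕ b) ⊕ a′) ⊕ ((c ⊕ a) ⊕ b′) ⊜ (c ⊕ c) ⊕ ((a ⊕ a′) ⊕ (b ⊕ b′))) refl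

  Θ∼f²-·-idempotent : ∀ a → Θ ∼f² (a · a) a
  Θ∼f²-·-idempotent a = curry (∼f²·a²≤a a) , curry (≤-trans (≤e⇒·≤ ∼f²≤e) (square-increasing a))

  module _ (∼f²≤f : ∼f² ≤ f) where
    Θ∼f²-f≈e : Θ ∼f² f e
    Θ∼f²-f≈e = ≤-refl , curry (≤-trans (≤-reflexive (·-identityʳ ∼f²)) ∼f²≤f)

    Θ∼f²-class-of-e : ∀ a → Θ ∼f² a e ⇔ (a ∈[ ∼f² , f² ])
    Θ∼f²-class-of-e a = mk⇔ to from
      where
      open IsEquivalence (IsCongruence.isEquivalence (Θ-isCongruence ∼f²≤e))
        using () renaming (sym to Θ-sym; trans to Θ-trans)

      to : Θ ∼f² a e → a ∈[ ∼f² , f² ]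
      to a≈e = ≤-trans (≤-reflexive (sym (·-identityʳ ∼f²))) (uncurry (proj₂ a≈e))
             , ∼f²·a≤f⇒a≤f² (uncurry (proj₁ (Θ-trans a≈e (Θ-sym Θ∼f²-f≈e))))

      from : a ∈[ ∼f² , f² ] → Θ ∼f² a e
      from (∼f²≤a , a≤f²) = curry (≤-trans (·-monoʳ-≤ a≤f²) ∼f²·f²≤e)
                          , curry (≤-trans (≤-reflexive (·-identityʳ ∼f²)) ∼f²≤a)

  module _ (fsi : FSI) where
    ¬idempotent⇒e≤f² : ¬ Idempotent → e ≤ f²
    ¬idempotent⇒e≤f² not-idempotent with FSI⇒e≤⊎≤f fsi f²
    ... | inj₁ e≤f² = e≤f²
    ... | inj₂ f²≤f = ⊥-elim (not-idempotent (f²≤f⇒idempotent f²≤f))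

    Θ∼f²-∧-selective : ∀ a b → Θ ∼f² (a ∧ b) a ⊎ Θ ∼f² (a ∧ b) b
    Θ∼f²-∧-selective a b with FSI⇒e≤⊎≤f fsi (∼f² · a · ∼ b)
    ... | inj₁ e≤∼f²·a·∼b = inj₂ (curry (≤-trans (≤e⇒·≤ ∼f²≤e) (x∧y≤y a b))
                                 , curry (∧-greatest (e≤∼f²·a·∼b⇒∼f²·b≤a e≤∼f²·a·∼b) (≤e⇒·≤ ∼f²≤e)))
    ... | inj₂ ∼f²·a·∼b≤f = inj₁ (curry (≤-trans (≤e⇒·≤ ∼f²≤e) (x∧y≤x a b))
                                 , curry (∧-greatest (≤e⇒·≤ ∼f²≤e) ∼f²·a≤b))
      where
      ∼f²·a≤b : ∼f² · a ≤ b
      ∼f²·a≤b = ≤-trans (·≤f⇒≤∼ ∼f²·a·∼b≤f) (≤-reflexive (involution b))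

    Θ∼f²-singleton-outside : ∀ a → ¬ (a ∈[ ∼f² , f² ]) → ∀ b → Θ ∼f² b a → b ≡ a
    Θ∼f²-singleton-outside a a∉ b b≈a with FSI⇒e≤⊎≤f fsi (∼f² · a) | FSI⇒e≤⊎≤f fsi (∼f² · ∼ a)
    ... | inj₁ e≤∼f²·a | _ = e≤∼f²·a⇒Θ-singleton e≤∼f²·a b≈a
    ... | inj₂ _ | inj₁ e≤∼f²·∼a = begin-equality
      b        ≡⟨ involution b ⟨
      ∼ ∼ b    ≡⟨ cong ∼_ (e≤∼f²·a⇒Θ-singleton e≤∼f²·∼a (IsCongruence.∼-cong (Θ-isCongruence ∼f²≤e) b≈a)) ⟩
      ∼ ∼ a    ≡⟨ involution a ⟩
      a        ∎
    ... | inj₂ ∼f²·a≤f | inj₂ ∼f²·∼a≤f = ⊥-elim (a∉ (∼f²·∼a≤f⇒∼f²≤a ∼f²·∼a≤f , ∼f²·a≤f⇒a≤f² ∼f²·a≤f))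

theorem7p16 : (A : DeMorganMonoid) → let open DeMorganMonoid A in
    ¬ Idempotent → FSI →
    let G = λ a → ∼ f² ≤ a in
    IsDeductiveFilter G
    × IsCongruence (λ a b → a ≈[ G ] b)
    × (∀ a → (a · a) ≈[ G ] a)
    × (f ≈[ G ] e)
    × (∀ a b → (a ∧ b) ≈[ G ] a ⊎ (a ∧ b) ≈[ G ] b)
    × (∀ a → (a ≈[ G ] e) ⇔ (a ∈[ ∼ f² , f² ]))
    × (∀ a → ¬ (a ∈[ ∼ f² , f² ]) → ∀ b → b ≈[ G ] a → b ≡ a)
theorem7p16 A not-idempotent fsi =
    ↑-isDeductiveFilter ∼f²≤e
  , Θ-isCongruence ∼f²≤e
  , Θ∼f²-·-idempotent
  , Θ∼f²-f≈e ∼f²≤f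
  , Θ∼f²-∧-selective fsi
  , Θ∼f²-class-of-e ∼f²≤f
  , Θ∼f²-singleton-outside fsi
  where
  open DeMorganMonoid A
  open DeMorganMonoidProperties A

  ∼f²≤f : ∼f² ≤ f
  ∼f²≤f = ∼-antitone (¬idempotent⇒e≤f² fsi not-idempotent)
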